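{- Let $AP$ be a set of atomic propositions, $\phi_0$ an $\mathrm{LTL}^{>}$ formula, $n\in\mathbb{N}$, and $\phi=\phi_0\wedge\phi_0[n+1]$. Then for every $u\in(2^{AP})^\omega$, $$\overline{[\![\phi]\!]}(u)=\begin{cases}\overline{[\![\phi_0]\!]}(u) & \text{if } \overline{[\![\phi_0]\!]}(u)>n,\\ 0 & \text{otherwise.}\end{cases}$$
   Context: Notation: for $u \in (2^{AP})^{\omega}$, $u_i$ is its $i$-th letter and $u^i$ its suffix starting at $u_i$. $\mathrm{LTL}^{\leq}$: grammar $\phi ::= a \mid \neg a \mid \phi\vee\phi \mid \phi\wedge\phi \mid \phi\mathbf{U}\phi \mid \phi\mathbf{R}\phi \mid \mathbf{X}\phi \mid \phi\mathbf{U}^{\leq}\phi$ ($a\in AP$); formulae without $\mathbf{U}^{\leq}$ are LTL formulae. $\mathrm{LTL}^{>}$: same grammar with $\phi\mathbf{R}^{>}\phi$ in place of $\phi\mathbf{U}^{\leq}\phi$. The relation $(u,n)\models_{\sup}$ for $\mathrm{LTL}^{>}$: $(u,n)\models a$ iff $a\in u_0$; $(u,n)\models\neg a$ iff $a\notin u_0$; $\vee,\wedge$ as usual; $(u,n)\models\mathbf{X}\phi_1$ iff $(u^1,n)\models\phi_1$; $\phi_1\mathbf{U}\phi_2$: some $i$ with $(u^i,n)\models\phi_2$ and $(u^j,n)\models\phi_1$ for all $j<i$; $\phi_1\mathbf{R}\phi_2$: for all $i$, $(u^i,n)\models\phi_2$ or some $j<i$ has $(u^j,n)\models\phi_1$;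 $(u,n)\models\phi_1\mathbf{R}^{>}\phi_2$ iff for every $i$, either $(u^i,n)\models\phi_2$ or $|\{j<i\mid (u^j,n)\models\phi_1\}|>n$. Value $\overline{[\![\phi]\!]}(u)=\sup\{n\mid (u,n)\models_{\sup}\phi\}$, $\sup\emptyset=0$. (An LTL formula is an $\mathrm{LTL}^{>}$ formula; it holds at $(u,n)$ for all $n$ or for none.) The analogous $\mathrm{LTL}^{\leq}$ relation $\models_{\inf}$ uses the same clauses and $(u,n)\models\phi_1\mathbf{U}^{\leq}\phi_2$ iff some $i$ has $(u^i,n)\models\phi_2$ and $|\{j<i\mid (u^j,n)\not\models\phi_1\}|\leq n$. Negation $\neg\phi$ swaps $\mathrm{LTL}^{\leq}$ and $\mathrm{LTL}^{>}$ formulae by pushing negation to the leaves: $a\leftrightarrow\neg a$, $\vee\leftrightarrow\wedge$, $\mathbf{U}\leftrightarrow\mathbf{R}$, $\mathbf{U}^{\leq}\leftrightarrow\mathbf{R}^{>}$, $\mathbf{X}$ self-dual. For an $\mathrm{LTL}^{\leq}$ formula, the LTL formula $\phi[n]$ is: $a[n]=a$, $(\neg a)[n]=\neg a$; $(\mathbf{X}\phi_1)[n]=\mathbf{X}(\phi_1[n])$; $(\phi_1\bowtie\phi_2)[n]=\phi_1[n]\bowtie\phi_2[n]$ for $\bowtie\in\{\vee,\wedge,\mathbf{U},\mathbf{R}\}$; if $\phi_1,\phi_2$ are LTL, $(\phi_1\mathbf{U}^{\leq}\phi_2)[0]=\phi_1\mathbf{U}\phi_2$ and $(\phi_1\mathbf{U}^{\leq}\phi_2)[n+1]=(\phi_1\vee\mathbf{X}((\phi_1\mathbf{U}^{\leq}\phi_2)[n]))\mathbf{U}\phi_2$;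 otherwise $(\phi_1\mathbf{U}^{\leq}\phi_2)[n]=(\phi_1[n]\mathbf{U}^{\leq}\phi_2[n])[n]$. For an $\mathrm{LTL}^{>}$ formula $\phi$, $\phi[n]:=\neg((\neg\phi)[n])$, an LTL formula. -}

module Defs where

open import Data.Nat using (ℕ; zero; suc; _+_; _<_; _≤_)
open import Data.Bool using (Bool; true)
open import Data.Fin using (Fin)
open import Data.Product using (Σ; ∃; _×_)
open import Data.Sum using (_⊎_)
open import Data.Unit using (⊤)
open import Relation.Nullary using (¬_)
open import Relation.Binary.PropositionalEquality using (_≡_)
open import Function.Definitions using (Injective)

-- Infinite words over 2^AP: a letter is a subset of AP, given by its characteristic function.
Word : Set → Set
Word AP = ℕ → (AP → Bool)

suffix : {AP : Set} → Word AP → ℕ → Word AP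
suffix u i = λ k → u (i + k)

data LTL (AP : Set) : Set where
  atom natom : AP → LTL AP
  _∨_ _∧_ _U_ _R_ : LTL AP → LTL AP → LTL AP
  X : LTL AP → LTL AP

data LTL≤ (AP : Set) : Set where
  atom natom : AP → LTL≤ AP
  _∨_ _∧_ _U_ _R_ _U≤_ : LTL≤ AP → LTL≤ AP → LTL≤ AP
  X : LTL≤ AP → LTL≤ AP

data LTL> (AP : Set) : Set where
  atom natom : AP → LTL> AP
  _∨_ _∧_ _U_ _R_ _R>_ : LTL> AP → LTL> AP → LTL> AP
  X : LTL> AP → LTL> AP

embed> : {AP : Set} → LTL AP → LTL> AP
embed> (atom a) = atom a
embed> (natom a) = natom a
embed> (φ ∨ ψ) = embed> φ ∨ embed> ψ
embed> (φ ∧ ψ) = embed> φ ∧ embed> ψ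
embed> (φ U ψ) = embed> φ U embed> ψ
embed> (φ R ψ) = embed> φ R embed> ψ
embed> (X φ) = X (embed> φ)

negL : {AP : Set} → LTL AP → LTL AP
negL (atom a) = natom a
negL (natom a) = atom a
negL (φ ∨ ψ) = negL φ ∧ negL ψ
negL (φ ∧ ψ) = negL φ ∨ negL ψ
negL (φ U ψ) = negL φ R negL ψ
negL (φ R ψ) = negL φ U negL ψ
negL (X φ) = X (negL φ)

neg> : {AP : Set} → LTL> AP → LTL≤ AP
neg> (atom a) = natom a
neg> (natom a) = atom a
neg> (φ ∨ ψ) = neg> φ ∧ neg> ψ
neg> (φ ∧ ψ) = neg> φ ∨ neg> ψ
neg> (φ U ψ) = neg> φ R neg> ψ
neg> (φ R ψ) = neg> φ U neg> ψ
neg> (φ R> ψ) = neg> φ U≤ neg> ψ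
neg> (X φ) = X (neg> φ)

unfoldU≤ : {AP : Set} → ℕ → LTL AP → LTL AP → LTL AP
unfoldU≤ zero φ ψ = φ U ψ
unfoldU≤ (suc k) φ ψ = (φ ∨ X (unfoldU≤ k φ ψ)) U ψ

-- In the U≤ case, φ1[n], φ2[n] are LTL, and
-- (φ1[n] U≤ φ2[n])[n] is given by the LTL-argument clause, i.e. unfoldU≤ n.
-- (When φ1, φ2 are already LTL, φ1[n] = φ1 and φ2[n] = φ2, so both clauses agree.)
_[_]≤ : {AP : Set} → LTL≤ AP → ℕ → LTL AP
atom a [ n ]≤ = atom a
natom a [ n ]≤ = natom a
(φ ∨ ψ) [ n ]≤ = (φ [ n ]≤) ∨ (ψ [ n ]≤)
(φ ∧ ψ) [ n ]≤ = (φ [ n ]≤) ∧ (ψ [ n ]≤)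
(φ U ψ) [ n ]≤ = (φ [ n ]≤) U (ψ [ n ]≤)
(φ R ψ) [ n ]≤ = (φ [ n ]≤) R (ψ [ n ]≤)
X φ [ n ]≤ = X (φ [ n ]≤)
(φ U≤ ψ) [ n ]≤ = unfoldU≤ n (φ [ n ]≤) (ψ [ n ]≤)

_[_]> : {AP : Set} → LTL> AP → ℕ → LTL AP
φ [ n ]> = negL (neg> φ [ n ]≤)

-- "|{ j < i | P j }| > n": there are n+1 distinct positions j < i satisfying P.
MoreThan : ℕ → ℕ → (ℕ → Set) → Set
MoreThan n i P =
  Σ (Fin (suc n) → ℕ) λ f → Injective _≡_ _≡_ f × (∀ k → f k < i × P (f k))

Sat : {AP : Set} → LTL> AP → Word AP → ℕ → Set
Sat (atom a) u n = u 0 a ≡ true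
Sat (natom a) u n = ¬ (u 0 a ≡ true)
Sat (φ ∨ ψ) u n = Sat φ u n ⊎ Sat ψ u n
Sat (φ ∧ ψ) u n = Sat φ u n × Sat ψ u n
Sat (X φ) u n = Sat φ (suffix u 1) n
Sat (φ U ψ) u n =
  ∃ λ i → Sat ψ (suffix u i) n × (∀ j → j < i → Sat φ (suffix u j) n)
Sat (φ R ψ) u n =
  ∀ i → Sat ψ (suffix u i) n ⊎ (∃ λ j → j < i × Sat φ (suffix u j) n)
Sat (φ R> ψ) u n =
  ∀ i → Sat ψ (suffix u i) n ⊎ MoreThan n i (λ j → Sat φ (suffix u j) n)

data ℕ∞ : Set where
  fin : ℕ → ℕ∞
  ∞ : ℕ∞

_>∞_ : ℕ∞ → ℕ → Set
fin k >∞ n = n < k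
∞ >∞ n = ⊤

-- IsSup S v : v = sup S in ℕ ∪ {∞}, with sup ∅ = 0.
IsSup : (ℕ → Set) → ℕ∞ → Set
IsSup S (fin k) = (∀ m → S m → m ≤ k) × (∀ b → (∀ m → S m → m ≤ b) → k ≤ b)
IsSup S ∞ = ∀ b → ¬ (∀ m → S m → m ≤ b)

Value : {AP : Set} → LTL> AP → Word AP → ℕ∞ → Set
Value φ u v = IsSup (λ n → Sat φ u n) v

-- A formula φ[k] is plain LTL, so its truth on u does not depend on the level m, and it
-- holds exactly when (u, k) ⊨ φ. Everything reduces to one combinatorial fact: "at every
-- i, ψ holds or φ held more than k times before i" is equivalent to the (k+1)-fold nested
-- release obtained by negating the unfolding of U≤.
-- Since satisfaction is antitone in the level, φ₀ ∧ φ₀[n+1] holds at level m iff φ₀ holds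
-- at levels m and n+1, so its satisfaction set is that of φ₀ when φ₀ holds at n+1, and is
-- empty otherwise.
module Submission where

open import Defs
open import Data.Nat using (ℕ; zero; suc; _+_; _∸_; _≤_; _<_; _⊔_; z≤n; s≤s; _≤?_; _≟_)
open import Data.Nat.Properties
open import Data.Fin using (Fin; punchIn; inject≤) renaming (zero to fzero; suc to fsuc)
open import Data.Fin.Properties using (punchInᵢ≢i; punchIn-injective; any?; inject≤-injective)
open import Data.List using (allFin)
open import Data.List.Relation.Unary.All using (lookup)
open import Data.List.Membership.Propositional.Properties using (∈-allFin)
open import Data.List.Extrema ≤-totalOrder using (argmin; f[argmin]≤f[xs])
open import Data.Product using (_×_; _,_; proj₁; proj₂; ∃-syntax)
import Data.Product as Product
open import Data.Product.Function.NonDependent.Propositional using (_×-⇔_)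
open import Data.Sum using (_⊎_; inj₁; inj₂)
import Data.Sum as Sum
open import Data.Sum.Function.Propositional using (_⊎-⇔_)
open import Data.Unit using (tt)
open import Function.Base using (_∘_)
open import Function.Bundles using (_⇔_; mk⇔; Equivalence)
open import Function.Construct.Composition using (_⇔-∘_)
open import Function.Construct.Identity using (⇔-id)
open import Function.Construct.Symmetry using (⇔-sym)
open import Function.Definitions using (Injective)
open import Relation.Nullary using (¬_; yes; no; contradiction)
open import Relation.Binary.PropositionalEquality

private
  variable
    AP : Set
    P P′ Q Q′ : ℕ → Set
    b c c′ i i′ j k m n t : ℕ
    v : ℕ∞

suffix-resp : {u w : Word AP} → u ≗ w → ∀ i → suffix u i ≗ suffix w i
suffix-resp u≗w i = u≗w ∘ (i +_)

suffix-step : (u : Word AP) (j y : ℕ) → suffix (suffix (suffix u j) 1) y ≗ suffix u (suc j + y)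
suffix-step u j y x = cong u (trans (+-suc j (y + x)) (cong suc (sym (+-assoc j y x))))

shift : ℕ → (ℕ → Set) → ℕ → Set
shift c P y = P (c + y)

From : ℕ → (ℕ → Set) → ℕ → Set
From c P p = c ≤ p × P p

SatAt : LTL> AP → Word AP → ℕ → ℕ → Set
SatAt φ u n j = Sat φ (suffix u j) n

MoreThan-map : (∀ p → P p → P′ p) → MoreThan n i P → MoreThan n i P′
MoreThan-map h (f , f-inj , f-ok) = f , f-inj , λ x → proj₁ (f-ok x) , h (f x) (proj₂ (f-ok x))

MoreThan-fewer : m ≤ n → MoreThan n i P → MoreThan m i P
MoreThan-fewer m≤n (f , f-inj , f-ok) =
  f ∘ ι , (λ eq → inject≤-injective _ _ _ _ (f-inj eq)) , f-ok ∘ ι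
  where
  ι = λ x → inject≤ x (s≤s m≤n)

MoreThan-later : i ≤ i′ → MoreThan n i P → MoreThan n i′ P
MoreThan-later i≤i′ (f , f-inj , f-ok) =
  f , f-inj , λ x → <-≤-trans (proj₁ (f-ok x)) i≤i′ , proj₂ (f-ok x)

MoreThan-witness : MoreThan n i P → ∃[ j ] j < i × P j
MoreThan-witness (f , _ , f-ok) = f fzero , f-ok fzero

MoreThan-singleton : j < i → P j → MoreThan 0 i P
MoreThan-singleton {j} j<i pⱼ = (λ _ → j) , (λ { {fzero} {fzero} _ → refl }) , λ _ → j<i , pⱼ

MoreThan-cons : j < i → P j → MoreThan n (i ∸ suc j) (shift (suc j) P) → MoreThan (suc n) i P
MoreThan-cons {j} {i} {P} {n} j<i pⱼ (f , f-inj , f-ok) = g , g-inj , g-ok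
  where
  g : Fin (suc (suc n)) → ℕ
  g fzero = j
  g (fsuc x) = suc j + f x
  j<g : ∀ x → j < g (fsuc x)
  j<g x = s≤s (m≤m+n j (f x))
  g-inj : Injective _≡_ _≡_ g
  g-inj {fzero} {fzero} _ = refl
  g-inj {fzero} {fsuc y} eq = contradiction eq (<⇒≢ (j<g y))
  g-inj {fsuc x} {fzero} eq = contradiction (sym eq) (<⇒≢ (j<g x))
  g-inj {fsuc x} {fsuc y} eq = cong fsuc (f-inj (+-cancelˡ-≡ (suc j) _ _ eq))
  g-ok : ∀ x → g x < i × P (g x)
  g-ok fzero = j<i , pⱼ
  g-ok (fsuc x) =
    subst (g (fsuc x) <_) (m+[n∸m]≡n j<i) (+-monoʳ-< (suc j) (proj₁ (f-ok x))) , proj₂ (f-ok x)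

MoreThan-remove : (c : ℕ) → MoreThan (suc n) i P → MoreThan n i (λ p → p ≢ c × P p)
MoreThan-remove c (f , f-inj , f-ok) = f ∘ punchIn x₀ , g-inj , g-ok
  where
  avoid : ∃[ x₀ ] ∀ y → f (punchIn x₀ y) ≢ c
  avoid with any? (λ x → f x ≟ c)
  ... | yes (x₀ , fx₀≡c) = x₀ , λ y e → punchInᵢ≢i x₀ y (f-inj (trans e (sym fx₀≡c)))
  ... | no c∉f = fzero , λ y e → c∉f (_ , e)
  x₀ = proj₁ avoid
  g-inj : Injective _≡_ _≡_ (f ∘ punchIn x₀)
  g-inj eq = punchIn-injective x₀ _ _ (f-inj eq)
  g-ok = λ y → proj₁ (f-ok (punchIn x₀ y)) , proj₂ avoid y , proj₂ (f-ok (punchIn x₀ y))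

MoreThan-shift : (c : ℕ) → MoreThan n (c + i) (From c P) → MoreThan n i (shift c P)
MoreThan-shift {i = i} {P = P} c (f , f-inj , f-ok) = g , g-inj , g-ok
  where
  g = λ x → f x ∸ c
  c+g≡f : ∀ x → c + g x ≡ f x
  c+g≡f x = m+[n∸m]≡n (proj₁ (proj₂ (f-ok x)))
  g-inj : Injective _≡_ _≡_ g
  g-inj eq = f-inj (trans (sym (c+g≡f _)) (trans (cong (c +_) eq) (c+g≡f _)))
  g-ok : ∀ x → g x < i × P (c + g x)
  g-ok x = +-cancelˡ-< c _ _ (subst (_< c + i) (sym (c+g≡f x)) (proj₁ (f-ok x)))
         , subst P (sym (c+g≡f x)) (proj₂ (proj₂ (f-ok x)))

MoreThan-after : MoreThan (suc n) t (From c P) → t ≤ suc c + i →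
  MoreThan n i (shift (suc c) P)
MoreThan-after {n = n} {t = t} {c = c} {P = P} more t≤ =
  MoreThan-shift {P = P} (suc c) (MoreThan-later {P = From (suc c) P} t≤ strictlyAfter)
  where
  strict : ∀ p → p ≢ c × From c P p → From (suc c) P p
  strict p (p≢c , c≤p , pₚ) = ≤∧≢⇒< c≤p (≢-sym p≢c) , pₚ
  strictlyAfter : MoreThan n t (From (suc c) P)
  strictlyAfter = MoreThan-map strict (MoreThan-remove {P = From c P} c more)

MoreThan-min : MoreThan n i P → ∃[ c ] P c × MoreThan n i (From c P)
MoreThan-min {n} (f , f-inj , f-ok) =
  f x₀ , proj₂ (f-ok x₀) , f , f-inj , λ x → proj₁ (f-ok x) , f-min x , proj₂ (f-ok x)
  where
  x₀ = argmin f fzero (allFin (suc n))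
  f-min : ∀ x → f x₀ ≤ f x
  f-min x = lookup (f[argmin]≤f[xs] {f = f} fzero (allFin (suc n))) (∈-allFin x)

From-weaken : c ≤ c′ → MoreThan n t (From c′ P) → MoreThan n t (From c P)
From-weaken {P = P} c≤c′ = MoreThan-map {P = From _ P} (λ _ → Product.map₁ (≤-trans c≤c′))

Until : (ℕ → Set) → (ℕ → Set) → Set
Until P Q = ∃[ i ] Q i × (∀ j → j < i → P j)

Release : (ℕ → Set) → (ℕ → Set) → Set
Release P Q = ∀ i → Q i ⊎ ∃[ j ] j < i × P j

ReleaseMoreThan : ℕ → (ℕ → Set) → (ℕ → Set) → Set
ReleaseMoreThan k P Q = ∀ i → Q i ⊎ MoreThan k i P

-- The semantics of the negated unfolding ¬((¬φ U≤ ¬ψ)[k]) = (φ ∧ X(…)) R ψ.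
NestedRelease : ℕ → (ℕ → Set) → (ℕ → Set) → Set
NestedRelease zero P Q = Release P Q
NestedRelease (suc k) P Q =
  ∀ i → Q i ⊎ ∃[ j ] j < i × P j × NestedRelease k (shift (suc j) P) (shift (suc j) Q)

monotone⇒cong : (F : (ℕ → Set) → (ℕ → Set) → Set) →
  (∀ {P P′ Q Q′} → (∀ p → P p → P′ p) → (∀ p → Q p → Q′ p) → F P Q → F P′ Q′) →
  (∀ p → P p ⇔ P′ p) → (∀ p → Q p ⇔ Q′ p) → F P Q ⇔ F P′ Q′
monotone⇒cong F map P⇔P′ Q⇔Q′ =
  mk⇔ (map (Equivalence.to ∘ P⇔P′) (Equivalence.to ∘ Q⇔Q′))
      (map (Equivalence.from ∘ P⇔P′) (Equivalence.from ∘ Q⇔Q′))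

Until-map : (∀ p → P p → P′ p) → (∀ p → Q p → Q′ p) → Until P Q → Until P′ Q′
Until-map hP hQ (i , qᵢ , p<ᵢ) = i , hQ i qᵢ , λ j j<i → hP j (p<ᵢ j j<i)

Release-map : (∀ p → P p → P′ p) → (∀ p → Q p → Q′ p) → Release P Q → Release P′ Q′
Release-map hP hQ r i = Sum.map (hQ i) (λ { (j , j<i , pⱼ) → j , j<i , hP j pⱼ }) (r i)

ReleaseMoreThan-map : (∀ p → P p → P′ p) → (∀ p → Q p → Q′ p) →
  ReleaseMoreThan k P Q → ReleaseMoreThan k P′ Q′
ReleaseMoreThan-map hP hQ r i = Sum.map (hQ i) (MoreThan-map hP) (r i)

ReleaseMoreThan-fewer : m ≤ n → ReleaseMoreThan n P Q → ReleaseMoreThan m P Q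
ReleaseMoreThan-fewer {P = P} m≤n r i = Sum.map₂ (MoreThan-fewer {P = P} m≤n) (r i)

NestedRelease-map : ∀ k → (∀ p → P p → P′ p) → (∀ p → Q p → Q′ p) →
  NestedRelease k P Q → NestedRelease k P′ Q′
NestedRelease-map zero hP hQ = Release-map hP hQ
NestedRelease-map (suc k) hP hQ r i = Sum.map (hQ i) step (r i)
  where
  step = λ { (j , j<i , pⱼ , r′) →
    j , j<i , hP j pⱼ , NestedRelease-map k (hP ∘ (suc j +_)) (hQ ∘ (suc j +_)) r′ }

NestedRelease⇒ReleaseMoreThan : ∀ k → NestedRelease k P Q → ReleaseMoreThan k P Q
NestedRelease⇒ReleaseMoreThan zero r i =
  Sum.map₂ (λ { (j , j<i , pⱼ) → MoreThan-singleton j<i pⱼ }) (r i)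
NestedRelease⇒ReleaseMoreThan {Q = Q} (suc k) r i with r i
... | inj₁ qᵢ = inj₁ qᵢ
... | inj₂ (j , j<i , pⱼ , r′) with NestedRelease⇒ReleaseMoreThan k r′ (i ∸ suc j)
...   | inj₁ q = inj₁ (subst Q (m+[n∸m]≡n j<i) q)
...   | inj₂ more = inj₂ (MoreThan-cons j<i pⱼ more)

Covered : ℕ → (ℕ → Set) → (ℕ → Set) → ℕ → ℕ → Set
Covered n P Q c i = ∀ t → t ≤ i → Q t ⊎ MoreThan n t (From c P)

Anchored : ℕ → (ℕ → Set) → (ℕ → Set) → ℕ → Set
Anchored n P Q i = (∀ t → t ≤ i → Q t) ⊎ ∃[ c ] P c × Covered n P Q c i

≤-suc-extend : {A : ℕ → Set} → (∀ t → t ≤ i → A t) → A (suc i) → ∀ t → t ≤ suc i → A t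
≤-suc-extend below top t t≤1+i with m≤n⇒m<n∨m≡n t≤1+i
... | inj₁ (s≤s t≤i) = below t t≤i
... | inj₂ refl = top

Covered-weaken : c ≤ c′ → Covered n P Q c′ i → Covered n P Q c i
Covered-weaken {P = P} c≤c′ cov t t≤i = Sum.map₂ (From-weaken {P = P} c≤c′) (cov t t≤i)

-- The anchor is the least position of any counting witness up to i, so every later witness
-- lies at or after it; removing the anchor then leaves enough positions strictly after it.
anchor : ReleaseMoreThan n P Q → ∀ i → Anchored n P Q i
anchor r zero with r zero
... | inj₁ q₀ = inj₁ λ { zero z≤n → q₀ }
... | inj₂ (_ , _ , f-ok) = contradiction (proj₁ (f-ok fzero)) n≮0
anchor {P = P} r (suc i) with anchor r i | r (suc i)
... | inj₁ allQ | inj₁ q = inj₁ (≤-suc-extend allQ q)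
... | inj₁ allQ | inj₂ more with MoreThan-min {P = P} more
...   | c , pᶜ , more′ = inj₂ (c , pᶜ , ≤-suc-extend (λ t → inj₁ ∘ allQ t) (inj₂ more′))
anchor {P = P} r (suc i) | inj₂ (c , pᶜ , cov) | inj₁ q = inj₂ (c , pᶜ , ≤-suc-extend cov (inj₁ q))
anchor {P = P} r (suc i) | inj₂ (c , pᶜ , cov) | inj₂ more with MoreThan-min {P = P} more
... | c′ , pᶜ′ , more′ with c ≤? c′
...   | yes c≤c′ = inj₂ (c , pᶜ , ≤-suc-extend cov (inj₂ (From-weaken {P = P} c≤c′ more′)))
...   | no c≰c′ =
  inj₂ (c′ , pᶜ′ , ≤-suc-extend (Covered-weaken {P = P} (≰⇒≥ c≰c′) cov) (inj₂ more′))

ReleaseMoreThan⇒NestedRelease : ∀ k → ReleaseMoreThan k P Q → NestedRelease k P Q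
ReleaseMoreThan⇒NestedRelease zero r i = Sum.map₂ MoreThan-witness (r i)
ReleaseMoreThan⇒NestedRelease {P = P} {Q = Q} (suc k) r i with anchor r i
... | inj₁ allQ = inj₁ (allQ i ≤-refl)
... | inj₂ (c , pᶜ , cov) with cov i ≤-refl
...   | inj₁ qᵢ = inj₁ qᵢ
...   | inj₂ moreᵢ = inj₂ (c , c<i , pᶜ , ReleaseMoreThan⇒NestedRelease k after)
  where
  c<i : c < i
  c<i = let (_ , j<i , c≤j , _) = MoreThan-witness {P = From c P} moreᵢ in ≤-<-trans c≤j j<i
  after : ReleaseMoreThan k (shift (suc c) P) (shift (suc c) Q)
  after i′ with suc c + i′ ≤? i
  ... | yes t≤i = Sum.map₂ (λ more → MoreThan-after {P = P} more ≤-refl) (cov (suc c + i′) t≤i)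
  ... | no t≰i = inj₂ (MoreThan-after {P = P} moreᵢ (≰⇒≥ t≰i))

ReleaseMoreThan⇔NestedRelease : ∀ k → ReleaseMoreThan k P Q ⇔ NestedRelease k P Q
ReleaseMoreThan⇔NestedRelease k =
  mk⇔ (ReleaseMoreThan⇒NestedRelease k) (NestedRelease⇒ReleaseMoreThan k)

Sat-resp-≗ : (φ : LTL> AP) {u w : Word AP} → u ≗ w → Sat φ u n → Sat φ w n
Sat-resp-≗ (atom a) u≗w s rewrite u≗w 0 = s
Sat-resp-≗ (natom a) u≗w s rewrite u≗w 0 = s
Sat-resp-≗ (φ ∨ ψ) u≗w = Sum.map (Sat-resp-≗ φ u≗w) (Sat-resp-≗ ψ u≗w)
Sat-resp-≗ (φ ∧ ψ) u≗w = Product.map (Sat-resp-≗ φ u≗w) (Sat-resp-≗ ψ u≗w)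
Sat-resp-≗ (X φ) u≗w = Sat-resp-≗ φ (u≗w ∘ suc)
Sat-resp-≗ (φ U ψ) u≗w =
  Until-map (Sat-resp-≗ φ ∘ suffix-resp u≗w) (Sat-resp-≗ ψ ∘ suffix-resp u≗w)
Sat-resp-≗ (φ R ψ) u≗w =
  Release-map (Sat-resp-≗ φ ∘ suffix-resp u≗w) (Sat-resp-≗ ψ ∘ suffix-resp u≗w)
Sat-resp-≗ (φ R> ψ) u≗w =
  ReleaseMoreThan-map (Sat-resp-≗ φ ∘ suffix-resp u≗w) (Sat-resp-≗ ψ ∘ suffix-resp u≗w)

Sat-antitone : (φ : LTL> AP) {u : Word AP} → m ≤ n → Sat φ u n → Sat φ u m
Sat-antitone (atom a) _ s = s
Sat-antitone (natom a) _ s = s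
Sat-antitone (φ ∨ ψ) m≤n = Sum.map (Sat-antitone φ m≤n) (Sat-antitone ψ m≤n)
Sat-antitone (φ ∧ ψ) m≤n = Product.map (Sat-antitone φ m≤n) (Sat-antitone ψ m≤n)
Sat-antitone (X φ) m≤n = Sat-antitone φ m≤n
Sat-antitone (φ U ψ) m≤n = Until-map (λ _ → Sat-antitone φ m≤n) (λ _ → Sat-antitone ψ m≤n)
Sat-antitone (φ R ψ) m≤n = Release-map (λ _ → Sat-antitone φ m≤n) (λ _ → Sat-antitone ψ m≤n)
Sat-antitone (φ R> ψ) {u} m≤n =
  ReleaseMoreThan-fewer {P = SatAt φ u _} m≤n
  ∘ ReleaseMoreThan-map (λ j → Sat-antitone φ {suffix u j} m≤n)
                        (λ i → Sat-antitone ψ {suffix u i} m≤n)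

Sat-negUnfold : (k : ℕ) (A B : LTL AP) (u : Word AP) (m : ℕ) →
  Sat (embed> (negL (unfoldU≤ k A B))) u m ⇔
  NestedRelease k (SatAt (embed> (negL A)) u m) (SatAt (embed> (negL B)) u m)
Sat-negUnfold zero A B u m = ⇔-id _
Sat-negUnfold (suc k) A B u m = mk⇔
  (λ s i → Sum.map₂ (λ { (j , j<i , a , r) → j , j<i , a ,
     NestedRelease-map k (realign A′ j) (realign B′ j) (Equivalence.to (IH j) r) }) (s i))
  (λ s i → Sum.map₂ (λ { (j , j<i , a , r) → j , j<i , a ,
     Equivalence.from (IH j) (NestedRelease-map k (unalign A′ j) (unalign B′ j) r) }) (s i))
  where
  A′ = embed> (negL A)
  B′ = embed> (negL B)
  IH = λ j → Sat-negUnfold k A B (suffix (suffix u j) 1) m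
  realign : ∀ φ j y → SatAt φ (suffix (suffix u j) 1) m y → SatAt φ u m (suc j + y)
  realign φ j y = Sat-resp-≗ φ (suffix-step u j y)
  unalign : ∀ φ j y → SatAt φ u m (suc j + y) → SatAt φ (suffix (suffix u j) 1) m y
  unalign φ j y = Sat-resp-≗ φ (sym ∘ suffix-step u j y)

Sat-translation : (φ : LTL> AP) (k m : ℕ) (u : Word AP) → Sat φ u k ⇔ Sat (embed> (φ [ k ]>)) u m
Sat-translation (atom a) k m u = ⇔-id _
Sat-translation (natom a) k m u = ⇔-id _
Sat-translation (φ ∨ ψ) k m u = Sat-translation φ k m u ⊎-⇔ Sat-translation ψ k m u
Sat-translation (φ ∧ ψ) k m u = Sat-translation φ k m u ×-⇔ Sat-translation ψ k m u
Sat-translation (X φ) k m u = Sat-translation φ k m (suffix u 1)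
Sat-translation (φ U ψ) k m u =
  monotone⇒cong Until Until-map
    (Sat-translation φ k m ∘ suffix u) (Sat-translation ψ k m ∘ suffix u)
Sat-translation (φ R ψ) k m u =
  monotone⇒cong Release Release-map
    (Sat-translation φ k m ∘ suffix u) (Sat-translation ψ k m ∘ suffix u)
Sat-translation (φ R> ψ) k m u =
  ⇔-sym (Sat-negUnfold k (neg> φ [ k ]≤) (neg> ψ [ k ]≤) u m)
  ⇔-∘ (ReleaseMoreThan⇔NestedRelease k
  ⇔-∘ monotone⇒cong (ReleaseMoreThan k) ReleaseMoreThan-map
        (Sat-translation φ k m ∘ suffix u) (Sat-translation ψ k m ∘ suffix u))

UpperBound : (ℕ → Set) → ℕ → Set
UpperBound S b = ∀ m → S m → m ≤ b

UpperBound-⊔ : {S T : ℕ → Set} → (∀ m → n < m → S m → T m) → UpperBound T b → UpperBound S (b ⊔ n)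
UpperBound-⊔ {n = n} {b = b} above T≤b m sₘ with m ≤? n
... | yes m≤n = ≤-trans m≤n (m≤n⊔m b n)
... | no m≰n = ≤-trans (T≤b m (above m (≰⇒> m≰n) sₘ)) (m≤m⊔n b n)

IsSup-agreeAbove : {S T : ℕ → Set} → (∀ m → T m → S m) → (∀ m → n < m → S m → T m) →
  v >∞ n → IsSup S v → IsSup T v
IsSup-agreeAbove {n = n} {v = fin k} T⊆S above n<k (S≤k , k≤) =
  (λ m → S≤k m ∘ T⊆S m) , k≤T-bound
  where
  k≤T-bound : ∀ b → UpperBound _ b → k ≤ b
  k≤T-bound b T≤b with ⊔-sel b n | k≤ (b ⊔ n) (UpperBound-⊔ above T≤b)
  ... | inj₁ b⊔n≡b | k≤b⊔n = subst (k ≤_) b⊔n≡b k≤b⊔n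
  ... | inj₂ b⊔n≡n | k≤b⊔n = contradiction (subst (k ≤_) b⊔n≡n k≤b⊔n) (<⇒≱ n<k)
IsSup-agreeAbove {v = ∞} _ above _ S-unbounded b = S-unbounded _ ∘ UpperBound-⊔ above

IsSup-vanish : {S T : ℕ → Set} → (∀ m → T m → S (suc n)) → ¬ (v >∞ n) → IsSup S v → IsSup T (fin 0)
IsSup-vanish {v = fin k} T⇒S1+n v≯n (S≤k , _) =
  (λ m tₘ → contradiction (S≤k _ (T⇒S1+n m tₘ)) v≯n) , λ _ _ → z≤n
IsSup-vanish {v = ∞} _ v≯n _ = contradiction tt v≯n

proposition8 : {AP : Set} (φ₀ : LTL> AP) (n : ℕ) (u : Word AP) (v : ℕ∞) →
    Value φ₀ u v →
    ((v >∞ n) → Value (φ₀ ∧ embed> (φ₀ [ suc n ]>)) u v) ×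
    (¬ (v >∞ n) → Value (φ₀ ∧ embed> (φ₀ [ suc n ]>)) u (fin 0))
proposition8 φ₀ n u v value =
  (λ v>n → IsSup-agreeAbove (λ _ → proj₁) holdsAbove v>n value) ,
  (λ v≯n → IsSup-vanish (λ m → Equivalence.from (translation m) ∘ proj₂) v≯n value)
  where
  translation : ∀ m → Sat φ₀ u (suc n) ⇔ Sat (embed> (φ₀ [ suc n ]>)) u m
  translation m = Sat-translation φ₀ (suc n) m u
  holdsAbove : ∀ m → n < m → Sat φ₀ u m → Sat (φ₀ ∧ embed> (φ₀ [ suc n ]>)) u m
  holdsAbove m n<m sₘ = sₘ , Equivalence.to (translation m) (Sat-antitone φ₀ n<m sₘ)
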